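{- Let $\mathcal F$ be the class of fully back-linked $\lambda$-term-graphs over $\Sigma^\lambda_{12}$, and let $\mathcal E$ be the class of eager-scope $\lambda$-term-graphs over $\Sigma^\lambda_{12}$. Both classes are closed under functional bisimulation. That is, for $\mathcal K\in\{\mathcal F,\mathcal E\}$: if $G\in\mathcal K$, $G'$ is a term graph over $\Sigma^\lambda_{12}$, and there is a homomorphism from $G$ to $G'$, then $G'\in\mathcal K$.
   Context: Term graphs. A term graph over a signature $\Sigma$ is a tuple $(V,\mathit{lab},\mathit{args},r)$, where: - $\mathit{args}(v)\in V^*$ has length equal to the arity of $\mathit{lab}(v)$; - every vertex is reachable from the root $r$. Write $w\rightarrowtail_kw'$ if $w'$ is the $k$-th entry (from $0$) of $\mathit{args}(w)$, and $w\rightarrowtail w'$ if this holds for some $k$. Homomorphisms. A homomorphism $h:G_1\to G_2$ satisfies $h(r_1)=r_2$, preserves labels, and has $\mathit{args}_2(h(v))=\bar h(\mathit{args}_1(v))$. Notation. $\Sigma^\lambda_{12}=\{@,\lambda,0,S\}$ with arities $2,1,1,2$. For words: $\epsilon$ is empty, juxtaposition is concatenation, $\le$ is the prefix order. $\lambda$-term-graphs. A $\lambda$-term-graph over $\Sigma^\lambda_{12}$ is a term graph over $\Sigma^\lambda_{12}$ admitting $P:V\to V^*$ with: - $P(r)=\epsilon$; - $\lambda$-vertex $w\rightarrowtail_0w_0$ implies $P(w_0)=P(w)w$; - $@$-vertex $w\rightarrowtail_kw_k$ implies $P(w_k)=P(w)$; - $0$-vertex $w$ implies $P(w)\ne\epsilon$;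 - $0$-vertex $w\rightarrowtail_0w_0$ implies $w_0$ labelled $\lambda$ and $P(w_0)w_0=P(w)$; - $S$-vertex $w\rightarrowtail_0w_0$ implies $P(w_0)v=P(w)$ for some $v$; - $S$-vertex $w\rightarrowtail_1w_1$ implies $w_1$ labelled $\lambda$ and $P(w_1)w_1=P(w)$. Such a $P$ is unique, and is called the abstraction-prefix function. Eager-scope. $G$ is eager-scope if, for all $w,v,p$ with $P(w)=pv$ and $w$ not labelled $S$, there exist $w=w_0\rightarrowtail\cdots\rightarrowtail w_n\rightarrowtail_0 v$ with $w_n$ labelled $0$ and $pv\le P(w_i)$ for $1\le i\le n-1$. Fully back-linked. $G$ is fully back-linked if, for all $w,v,p$ with $P(w)=pv$, there exist $w=w_0\rightarrowtail\cdots\rightarrowtail w_n\rightarrowtail v$ with $pv\le P(w_i)$ for $0\le i\le n$. -}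

module Defs where

open import Data.Nat using (ℕ; zero; suc; _≤_; _<_)
open import Data.Fin using (Fin; toℕ)
open import Data.Vec using (Vec; lookup)
open import Data.List using (List; []; _∷_; _++_; [_])
open import Data.Product using (Σ; ∃; _×_; _,_)
open import Relation.Binary.PropositionalEquality using (_≡_; _≢_)
open import Relation.Binary.Construct.Closure.ReflexiveTransitive using (Star)

data Lab : Set where
  app lam zer S : Lab

arity : Lab → ℕ
arity app = 2
arity lam = 1
arity zer = 1
arity S   = 2

record TermGraph : Set₁ where
  field
    V    : Set
    lab  : V → Lab
    args : (v : V) → Vec V (arity (lab v))
    root : V

  -- w ↣_k w' : w' is the k-th entry (from 0) of args(w)
  EdgeAt : V → ℕ → V → Set
  EdgeAt w k w' = Σ (Fin (arity (lab w))) λ i → (toℕ i ≡ k) × (lookup (args w) i ≡ w')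

  Edge : V → V → Set
  Edge w w' = ∃ λ k → EdgeAt w k w'

  field
    reachable : (v : V) → Star Edge root v

open TermGraph public

record Hom (G₁ G₂ : TermGraph) : Set where
  field
    h        : V G₁ → V G₂
    h-root   : h (root G₁) ≡ root G₂
    h-lab    : (v : V G₁) → lab G₂ (h v) ≡ lab G₁ v
    h-args   : (v : V G₁) (k : ℕ) (w : V G₁) → EdgeAt G₁ v k w → EdgeAt G₂ (h v) k (h w)

_≼_ : {A : Set} → List A → List A → Set
xs ≼ ys = ∃ λ zs → xs ++ zs ≡ ys

record IsAbsPrefix (G : TermGraph) (P : V G → List (V G)) : Set where
  field
    root-ε   : P (root G) ≡ []
    lam-arg  : ∀ w w₀ → lab G w ≡ lam → EdgeAt G w 0 w₀ → P w₀ ≡ P w ++ [ w ]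
    app-arg  : ∀ w k wₖ → lab G w ≡ app → EdgeAt G w k wₖ → P wₖ ≡ P w
    zer-ne   : ∀ w → lab G w ≡ zer → P w ≢ []
    zer-arg  : ∀ w w₀ → lab G w ≡ zer → EdgeAt G w 0 w₀ →
                 (lab G w₀ ≡ lam) × (P w₀ ++ [ w₀ ] ≡ P w)
    S-arg₀   : ∀ w w₀ → lab G w ≡ S → EdgeAt G w 0 w₀ →
                 ∃ λ v → P w₀ ++ [ v ] ≡ P w
    S-arg₁   : ∀ w w₁ → lab G w ≡ S → EdgeAt G w 1 w₁ →
                 (lab G w₁ ≡ lam) × (P w₁ ++ [ w₁ ] ≡ P w)

IsLambdaTermGraph : TermGraph → Set
IsLambdaTermGraph G = ∃ λ P → IsAbsPrefix G P

EagerScopeWrt : (G : TermGraph) → (V G → List (V G)) → Set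
EagerScopeWrt G P = ∀ w v p → P w ≡ p ++ [ v ] → lab G w ≢ S →
  ∃ λ (n : ℕ) → ∃ λ (ws : ℕ → V G) →
    (ws 0 ≡ w)
    × (∀ i → i < n → Edge G (ws i) (ws (suc i)))
    × (lab G (ws n) ≡ zer)
    × EdgeAt G (ws n) 0 v
    × (∀ i → 1 ≤ i → suc i ≤ n → (p ++ [ v ]) ≼ P (ws i))

FullyBackLinkedWrt : (G : TermGraph) → (V G → List (V G)) → Set
FullyBackLinkedWrt G P = ∀ w v p → P w ≡ p ++ [ v ] →
  ∃ λ (n : ℕ) → ∃ λ (ws : ℕ → V G) →
    (ws 0 ≡ w)
    × (∀ i → i < n → Edge G (ws i) (ws (suc i)))
    × Edge G (ws n) v
    × (∀ i → i ≤ n → (p ++ [ v ]) ≼ P (ws i))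

-- the classes 𝓔 and 𝓕 (P is the abstraction-prefix function, unique when it exists)
EagerScope : TermGraph → Set
EagerScope G = ∃ λ P → IsAbsPrefix G P × EagerScopeWrt G P

FullyBackLinked : TermGraph → Set
FullyBackLinked G = ∃ λ P → IsAbsPrefix G P × FullyBackLinkedWrt G P

-- Given a homomorphism h : G → G′ and the abstraction-prefix function P of G, the function
-- P′ (h w) = map h (P w) is well defined, is an abstraction-prefix function of G′, and h carries
-- the paths witnessing full back-linkedness or eager scope in G to such paths in G′.
-- Well-definedness, h a ≡ h b → map h (P a) ≡ map h (P b), goes by induction on |P a| + |P b|.
-- A 0- or S-vertex reduces to the λ binding it, whose prefix is one shorter. Any other vertex w
-- with P w = p ∷ʳ v has a path back to v inside the scope p ∷ʳ v; walking it from w and, in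
-- parallel, from a vertex w′ with h w′ = h w keeps the growth of both prefixes equal under h,
-- and the path can only reach v by a pop from a 0- or S-vertex whose prefix is again P w.
module Submission where

open import Defs
open import Data.Empty using (⊥-elim)
open import Data.Fin using (Fin; toℕ) renaming (zero to fzero; suc to fsuc)
open import Data.Fin.Properties using (toℕ-injective)
open import Data.List using (List; []; _∷_; _++_; [_]; _∷ʳ_; map; length; initLast; _∷ʳ′_)
open import Data.List.Properties
  using ( ++-assoc; ++-identityʳ; ++-cancelˡ; ++-conicalʳ; map-++; length-++
        ; ∷-injectiveʳ; ∷ʳ-injective; ∷ʳ-injectiveˡ)
open import Data.Nat using (ℕ; zero; suc; _+_; _≤_; _<_; z≤n; s≤s; s≤s⁻¹; _≟_)
open import Data.Nat.Properties using (≤-refl; ≤-trans; n≤1+n; +-comm; m≤m+n; m≤n+m; ≤∧≢⇒<)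
open import Data.Product using (∃; ∃₂; _×_; _,_; proj₁; proj₂)
open import Data.Sum using (_⊎_; inj₁; inj₂)
open import Data.Vec using (lookup)
open import Function using (_∘_)
open import Relation.Nullary using (yes; no)
open import Relation.Binary.PropositionalEquality
  using (_≡_; _≢_; refl; sym; trans; cong; cong₂; subst; subst₂; module ≡-Reasoning)
open import Relation.Binary.Construct.Closure.ReflexiveTransitive using (Star; ε; _◅_)

module _ {A : Set} where

  xs≢xs∷ʳy++ys : ∀ (xs : List A) y ys → xs ≢ xs ∷ʳ y ++ ys
  xs≢xs∷ʳy++ys []       y ys ()
  xs≢xs∷ʳy++ys (x ∷ xs) y ys eq = xs≢xs∷ʳy++ys xs y ys (∷-injectiveʳ eq)

  length-∷ʳ : ∀ (xs : List A) x → length (xs ∷ʳ x) ≡ suc (length xs)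
  length-∷ʳ xs x = trans (length-++ xs) (+-comm (length xs) 1)

  ∷ʳ-length-< : ∀ {n} {xs : List A} {x ys} → xs ∷ʳ x ≡ ys → length ys < suc n → length xs < n
  ∷ʳ-length-< {xs = xs} {x} refl lt = s≤s⁻¹ (subst (_< _) (length-∷ʳ xs x) lt)

  ∷ʳ-view : ∀ (xs : List A) → xs ≡ [] ⊎ ∃₂ λ ys y → xs ≡ ys ∷ʳ y
  ∷ʳ-view xs with initLast xs
  ... | []       = inj₁ refl
  ... | ys ∷ʳ′ y = inj₂ (ys , y , refl)

  ∷ʳ≡++∷ : ∀ (xs : List A) x q u r → xs ∷ʳ x ≡ q ++ u ∷ r →
           (q ≡ xs × u ≡ x) ⊎ ∃ λ r′ → xs ≡ q ++ u ∷ r′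
  ∷ʳ≡++∷ xs x q u r eq with initLast r
  ... | []        = let xs≡q , x≡u = ∷ʳ-injective xs q eq in inj₁ (sym xs≡q , sym x≡u)
  ... | r′ ∷ʳ′ y  =
    inj₂ (r′ , ∷ʳ-injectiveˡ xs (q ++ u ∷ r′) (trans eq (sym (++-assoc q (u ∷ r′) [ y ]))))

  ≡⇒≼ : ∀ {xs ys : List A} → xs ≡ ys → xs ≼ ys
  ≡⇒≼ {xs} eq = [] , trans (++-identityʳ xs) eq

  module _ {B : Set} (f : A → B) where

    map-∷ʳ : ∀ xs x → map f (xs ∷ʳ x) ≡ map f xs ∷ʳ f x
    map-∷ʳ xs x = map-++ f xs [ x ]

    map-∷ʳ-cong : ∀ {xs ys x y} → map f xs ≡ map f ys → f x ≡ f y →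
                  map f (xs ∷ʳ x) ≡ map f (ys ∷ʳ y)
    map-∷ʳ-cong {xs} {ys} {x} {y} eq fx≡fy = begin
      map f (xs ∷ʳ x)   ≡⟨ map-∷ʳ xs x ⟩
      map f xs ∷ʳ f x   ≡⟨ cong₂ _∷ʳ_ eq fx≡fy ⟩
      map f ys ∷ʳ f y   ≡⟨ map-∷ʳ ys y ⟨
      map f (ys ∷ʳ y)   ∎
      where open ≡-Reasoning

    map-≡-[] : ∀ xs → map f xs ≡ [] → xs ≡ []
    map-≡-[] [] _ = refl

    map-≡-∷ʳ : ∀ xs ys b → map f xs ≡ ys ∷ʳ b →
               ∃₂ λ t z → xs ≡ t ∷ʳ z × map f t ≡ ys × f z ≡ b
    map-≡-∷ʳ xs ys b eq with initLast xs
    map-≡-∷ʳ xs ys b eq | [] with ++-conicalʳ ys [ b ] (sym eq)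
    ... | ()
    map-≡-∷ʳ xs ys b eq | t ∷ʳ′ z =
      let ft≡ys , fz≡b = ∷ʳ-injective (map f t) ys (trans (sym (map-∷ʳ t z)) eq)
      in t , z , refl , ft≡ys , fz≡b

module _ (G : TermGraph) where

  reachable-induction : (Q : V G → Set) → Q (root G) → (∀ {a b} → Edge G a b → Q a → Q b) →
                        ∀ v → Q v
  reachable-induction Q q-root q-step v = go (reachable G v) q-root
    where
      go : ∀ {a} → Star (Edge G) a v → Q a → Q v
      go ε        q = q
      go (e ◅ es) q = go es (q-step e q)

  EdgeAt-functional : ∀ {w k u u′} → EdgeAt G w k u → EdgeAt G w k u′ → u ≡ u′
  EdgeAt-functional {w} (i , refl , refl) (j , j≡i , refl) = cong (lookup (args G w)) (toℕ-injective (sym j≡i))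

  edge-index : ∀ {w k u l} → EdgeAt G w k u → lab G w ≡ l → ∃ λ (j : Fin (arity l)) → toℕ j ≡ k
  edge-index (i , refl , _) refl = i , refl

  edge-at : ∀ {w l} → lab G w ≡ l → (j : Fin (arity l)) → ∃ λ u → EdgeAt G w (toℕ j) u
  edge-at {w} refl j = lookup (args G w) j , j , refl , refl

module _ {G G′ : TermGraph} (H : Hom G G′) where
  open Hom H

  lab-reflect : ∀ {w l} → lab G′ (h w) ≡ l → lab G w ≡ l
  lab-reflect {w} = trans (sym (h-lab w))

  lab-fiber : ∀ {a b} → h a ≡ h b → lab G a ≡ lab G b
  lab-fiber {b = b} eq = lab-reflect (trans (cong (lab G′) eq) (h-lab b))

  map-Edge : ∀ {a b} → Edge G a b → Edge G′ (h a) (h b)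
  map-Edge (k , e) = k , h-args _ k _ e

  lift-edge : ∀ {w k u′} → EdgeAt G′ (h w) k u′ → ∃ λ u → EdgeAt G w k u × h u ≡ u′
  lift-edge {w} e′ with edge-index G′ e′ (h-lab w)
  ... | j , refl with edge-at G refl j
  ... | u , e = u , e , EdgeAt-functional G′ (h-args w _ u e) e′

  lift-parallel-edge : ∀ {a a′ k b} → h a ≡ h a′ → EdgeAt G a k b →
                       ∃ λ b′ → EdgeAt G a′ k b′ × h b′ ≡ h b
  lift-parallel-edge {a} {k = k} {b} eq e = lift-edge (subst (λ x → EdgeAt G′ x k (h b)) eq (h-args a k b e))

  surjective : ∀ v′ → ∃ λ v → h v ≡ v′
  surjective = reachable-induction G′ (λ v′ → ∃ λ v → h v ≡ v′) (root G , h-root) step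
    where
      step : ∀ {a′ b′} → Edge G′ a′ b′ → ∃ (λ a → h a ≡ a′) → ∃ λ b → h b ≡ b′
      step (k , e′) (a , refl) = let b , _ , hb≡b′ = lift-edge e′ in b , hb≡b′

ScopePath : (G : TermGraph) → (V G → List (V G)) → V G → V G → List (V G) → Set
ScopePath G P w v p = ∃ λ (n : ℕ) → ∃ λ (ws : ℕ → V G) →
  (ws 0 ≡ w)
  × (∀ i → i < n → Edge G (ws i) (ws (suc i)))
  × Edge G (ws n) v
  × (∀ i → i ≤ n → (p ∷ʳ v) ≼ P (ws i))

EagerPath : (G : TermGraph) → (V G → List (V G)) → V G → V G → List (V G) → Set
EagerPath G P w v p = ∃ λ (n : ℕ) → ∃ λ (ws : ℕ → V G) →
  (ws 0 ≡ w)
  × (∀ i → i < n → Edge G (ws i) (ws (suc i)))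
  × (lab G (ws n) ≡ zer)
  × EdgeAt G (ws n) 0 v
  × (∀ i → 1 ≤ i → suc i ≤ n → (p ∷ʳ v) ≼ P (ws i))

HasScopePaths : (G : TermGraph) → (V G → List (V G)) → Set
HasScopePaths G P = ∀ w v p → P w ≡ p ∷ʳ v → lab G w ≢ S → ScopePath G P w v p

PrefixStep : (G : TermGraph) → (V G → List (V G)) → Lab → V G → V G → Set
PrefixStep G P app w w′ = P w′ ≡ P w
PrefixStep G P lam w w′ = P w′ ≡ P w ∷ʳ w
PrefixStep G P zer w w′ = ∃ λ x → P w′ ∷ʳ x ≡ P w
PrefixStep G P S   w w′ = ∃ λ x → P w′ ∷ʳ x ≡ P w

-- Binder l k: the k-th argument of an l-vertex is the λ that binds it.
data Binder : Lab → ℕ → Set where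
  zer : Binder zer 0
  S   : Binder S 1

binder? : ∀ l → ∃ (Binder l) ⊎ l ≢ S
binder? app = inj₂ λ ()
binder? lam = inj₂ λ ()
binder? zer = inj₁ (0 , zer)
binder? S   = inj₁ (1 , S)

module _ {G : TermGraph} {P : V G → List (V G)} (isP : IsAbsPrefix G P) where
  open IsAbsPrefix isP

  prefix-step-at : ∀ {w k w′} l → lab G w ≡ l → EdgeAt G w k w′ → PrefixStep G P l w w′
  prefix-step-at app eq e = app-arg _ _ _ eq e
  prefix-step-at lam eq e with edge-index G e eq
  ... | fzero , refl = lam-arg _ _ eq e
  prefix-step-at zer eq e with edge-index G e eq
  ... | fzero , refl = _ , proj₂ (zer-arg _ _ eq e)
  prefix-step-at S eq e with edge-index G e eq
  ... | fzero , refl      = S-arg₀ _ _ eq e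
  ... | fsuc fzero , refl = _ , proj₂ (S-arg₁ _ _ eq e)

  prefix-step : ∀ {w w′} → Edge G w w′ → PrefixStep G P (lab G w) w w′
  prefix-step (_ , e) = prefix-step-at _ refl e

  binder-edge : ∀ {a l k} → lab G a ≡ l → Binder l k → ∃ λ y → EdgeAt G a k y
  binder-edge eq zer = edge-at G eq fzero
  binder-edge eq S   = edge-at G eq (fsuc fzero)

  binds : ∀ {a l k y} → lab G a ≡ l → Binder l k → EdgeAt G a k y → P y ∷ʳ y ≡ P a
  binds eq zer e = proj₂ (zer-arg _ _ eq e)
  binds eq S   e = proj₂ (S-arg₁ _ _ eq e)

  P-of-entry : ∀ a q u r → P a ≡ q ++ u ∷ r → P u ≡ q
  P-of-entry = reachable-induction G EntriesScoped root-scoped (λ {a} e → step (lab G a) (prefix-step e))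
    where
      EntriesScoped : V G → Set
      EntriesScoped a = ∀ q u r → P a ≡ q ++ u ∷ r → P u ≡ q

      root-scoped : EntriesScoped (root G)
      root-scoped q u r eq with ++-conicalʳ q (u ∷ r) (trans (sym eq) root-ε)
      ... | ()

      pop : ∀ {a b} → (∃ λ x → P b ∷ʳ x ≡ P a) → EntriesScoped a → EntriesScoped b
      pop {b = b} (x , Pb∷ʳx≡Pa) scoped q u r Pb≡ =
        scoped q u (r ∷ʳ x) (trans (sym Pb∷ʳx≡Pa) (trans (cong (_∷ʳ x) Pb≡) (++-assoc q (u ∷ r) [ x ])))

      step : ∀ {a b} l → PrefixStep G P l a b → EntriesScoped a → EntriesScoped b
      step app Pb≡Pa scoped q u r Pb≡ = scoped q u r (trans (sym Pb≡Pa) Pb≡)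
      step {a} lam Pb≡ scoped q u r Pb≡′ with ∷ʳ≡++∷ (P a) a q u r (trans (sym Pb≡) Pb≡′)
      ... | inj₁ (q≡Pa , refl) = sym q≡Pa
      ... | inj₂ (r′ , Pa≡)    = scoped q u r′ Pa≡
      step zer = pop
      step S   = pop

  eager⇒scope-path : ∀ {w v p} → P w ≡ p ∷ʳ v → EagerPath G P w v p → ScopePath G P w v p
  eager⇒scope-path {w} {v} {p} Pw≡ (n , ws , ws0≡w , steps , last-zer , last-edge , inner) =
    n , ws , ws0≡w , steps , (0 , last-edge) , inside
    where
      inside : ∀ i → i ≤ n → (p ∷ʳ v) ≼ P (ws i)
      inside zero _ = ≡⇒≼ (sym (trans (cong P ws0≡w) Pw≡))
      inside (suc i) i<n with suc i ≟ n
      ... | yes refl = ≡⇒≼ (trans (cong (_∷ʳ v) (sym (P-of-entry w p v [] Pw≡)))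
                                  (proj₂ (zer-arg _ v last-zer last-edge)))
      ... | no i≢n   = inner (suc i) (s≤s z≤n) (≤∧≢⇒< i<n i≢n)

  eager⇒scoped : EagerScopeWrt G P → HasScopePaths G P
  eager⇒scoped es w v p Pw≡ w≢S = eager⇒scope-path Pw≡ (es w v p Pw≡ w≢S)

module _ {G G′ : TermGraph} (H : Hom G G′) {P : V G → List (V G)} (isP : IsAbsPrefix G P)
         (scoped : HasScopePaths G P) where
  open Hom H
  open IsAbsPrefix isP

  Parallel : List (V G) → List (V G) → V G → V G → Set
  Parallel pv q u u′ = ∃₂ λ s s′ → P u ≡ pv ++ s × P u′ ≡ q ++ s′ × map h s ≡ map h s′

  -- pv ≼ P u₂ ensures that the popped entry lies in the suffix s rather than in pv.
  parallel-pop : ∀ {pv q u u′ u₂ u₂′} →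
                 (∃ λ x → P u₂ ∷ʳ x ≡ P u) → (∃ λ x → P u₂′ ∷ʳ x ≡ P u′) →
                 pv ≼ P u₂ → Parallel pv q u u′ → Parallel pv q u₂ u₂′
  parallel-pop {pv} {q} {u} {u₂ = u₂} {u₂′}
               (x , Pu₂∷ʳx≡) (_ , Pu₂′∷ʳx′≡) (t , pv++t≡) (s , s′ , Pu≡ , Pu′≡ , hs≡) =
    let t′ , z , s′≡ , ht′≡ht , _ = map-≡-∷ʳ h s′ (map h t) (h x) hs′≡
        Pu₂′≡ = ∷ʳ-injectiveˡ (P u₂′) (q ++ t′)
                  (trans Pu₂′∷ʳx′≡ (trans Pu′≡ (trans (cong (q ++_) s′≡) (sym (++-assoc q t′ [ z ])))))
    in t , t′ , sym pv++t≡ , Pu₂′≡ , sym ht′≡ht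
    where
      open ≡-Reasoning
      s≡t∷ʳx : s ≡ t ∷ʳ x
      s≡t∷ʳx = sym (++-cancelˡ pv (t ∷ʳ x) s (begin
        pv ++ t ∷ʳ x     ≡⟨ ++-assoc pv t [ x ] ⟨
        (pv ++ t) ∷ʳ x   ≡⟨ cong (_∷ʳ x) pv++t≡ ⟩
        P u₂ ∷ʳ x        ≡⟨ Pu₂∷ʳx≡ ⟩
        P u              ≡⟨ Pu≡ ⟩
        pv ++ s          ∎))
      hs′≡ : map h s′ ≡ map h t ∷ʳ h x
      hs′≡ = trans (sym hs≡) (trans (cong (map h) s≡t∷ʳx) (map-∷ʳ h t x))

  parallel-step : ∀ {pv q u u′ u₂ u₂′} l → PrefixStep G P l u u₂ → PrefixStep G P l u′ u₂′ →
                  h u ≡ h u′ → pv ≼ P u₂ → Parallel pv q u u′ → Parallel pv q u₂ u₂′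
  parallel-step app Pu₂≡ Pu₂′≡ _ _ (s , s′ , Pu≡ , Pu′≡ , hs≡) =
    s , s′ , trans Pu₂≡ Pu≡ , trans Pu₂′≡ Pu′≡ , hs≡
  parallel-step {pv} {q} {u} {u′} lam Pu₂≡ Pu₂′≡ hu≡ _ (s , s′ , Pu≡ , Pu′≡ , hs≡) =
    s ∷ʳ u , s′ ∷ʳ u′ ,
    trans Pu₂≡ (trans (cong (_∷ʳ u) Pu≡) (++-assoc pv s [ u ])) ,
    trans Pu₂′≡ (trans (cong (_∷ʳ u′) Pu′≡) (++-assoc q s′ [ u′ ])) ,
    map-∷ʳ-cong h hs≡ hu≡
  parallel-step zer pop pop′ _ = parallel-pop pop pop′
  parallel-step S   pop pop′ _ = parallel-pop pop pop′

  exit-pop : ∀ {p v q uₙ u′} → (∃ λ x → P v ∷ʳ x ≡ P uₙ) → P v ≡ p →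
             Parallel (p ∷ʳ v) q uₙ u′ →
             P uₙ ≡ p ∷ʳ v × P u′ ≡ q
  exit-pop {p} {v} {q} (x , Pv∷ʳx≡) Pv≡p (s , s′ , Puₙ≡ , Pu′≡ , hs≡) =
    trans Puₙ≡ (trans (cong ((p ∷ʳ v) ++_) s≡[]) (++-identityʳ (p ∷ʳ v))) ,
    trans Pu′≡ (trans (cong (q ++_) s′≡[]) (++-identityʳ q))
    where
      s≡[] : s ≡ []
      s≡[] = sym (∷-injectiveʳ (++-cancelˡ p [ x ] (v ∷ s)
               (trans (cong (_∷ʳ x) (sym Pv≡p)) (trans Pv∷ʳx≡ (trans Puₙ≡ (++-assoc p [ v ] s))))))
      s′≡[] : s′ ≡ []
      s′≡[] = map-≡-[] h s′ (trans (sym hs≡) (cong (map h) s≡[]))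

  -- Since P v ≡ p, an edge into v cannot leave an app or lam vertex inside the scope p ∷ʳ v,
  -- and a pop into v can only come from a vertex with prefix exactly p ∷ʳ v.
  scope-exit : ∀ {p v q uₙ u′} l → PrefixStep G P l uₙ v → P v ≡ p → Parallel (p ∷ʳ v) q uₙ u′ →
               ∃ (Binder l) × P uₙ ≡ p ∷ʳ v × P u′ ≡ q
  scope-exit {p} {v} app Pv≡Puₙ Pv≡p (s , _ , Puₙ≡ , _) =
    ⊥-elim (xs≢xs∷ʳy++ys p v s (trans (sym Pv≡p) (trans Pv≡Puₙ Puₙ≡)))
  scope-exit {p} {v} {uₙ = uₙ} lam Pv≡ Pv≡p (s , _ , Puₙ≡ , _) =
    ⊥-elim (xs≢xs∷ʳy++ys p v (s ∷ʳ uₙ)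
      (trans (sym Pv≡p) (trans Pv≡ (trans (cong (_∷ʳ uₙ) Puₙ≡) (++-assoc (p ∷ʳ v) s [ uₙ ])))))
  scope-exit zer pop Pv≡p par = (0 , zer) , exit-pop pop Pv≡p par
  scope-exit S   pop Pv≡p par = (1 , S) , exit-pop pop Pv≡p par

  Shadowed : List (V G) → List (V G) → V G → Set
  Shadowed pv q u = ∃ λ u′ → h u ≡ h u′ × Parallel pv q u u′

  shadowed-start : ∀ {pv w w′} → h w ≡ h w′ → P w ≡ pv → Shadowed pv (P w′) w
  shadowed-start {pv} {w′ = w′} hw≡ Pw≡ =
    w′ , hw≡ , [] , [] , trans Pw≡ (sym (++-identityʳ pv)) , sym (++-identityʳ (P w′)) , refl

  shadowed-step : ∀ {pv q u u₂} → Edge G u u₂ → pv ≼ P u₂ → Shadowed pv q u → Shadowed pv q u₂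
  shadowed-step {u = u} (k , e) pv≼ (u′ , hu≡ , par) =
    let u₂′ , e′ , hu₂′≡ = lift-parallel-edge H hu≡ e
        step′ = subst (λ l → PrefixStep G P l u′ u₂′) (lab-fiber H (sym hu≡)) (prefix-step isP (k , e′))
    in u₂′ , sym hu₂′≡ , parallel-step (lab G u) (prefix-step isP (k , e)) step′ hu≡ pv≼ par

  shadowed-along : ∀ {pv q} n (ws : ℕ → V G) → Shadowed pv q (ws 0) →
                   (∀ i → i < n → Edge G (ws i) (ws (suc i))) → (∀ i → i ≤ n → pv ≼ P (ws i)) →
                   ∀ i → i ≤ n → Shadowed pv q (ws i)
  shadowed-along n ws sh₀ steps inside zero    _   = sh₀
  shadowed-along n ws sh₀ steps inside (suc i) i<n =
    shadowed-step (steps i i<n) (inside (suc i) i<n)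
      (shadowed-along n ws sh₀ steps inside i (≤-trans (n≤1+n i) i<n))

  FiberAgrees : ℕ → Set
  FiberAgrees n = ∀ a b → h a ≡ h b → length (P a) < n → length (P b) < n → map h (P a) ≡ map h (P b)

  binder-case : ∀ {n a b l k} → FiberAgrees n → h a ≡ h b → lab G a ≡ l → Binder l k →
                length (P a) < suc n → length (P b) < suc n → map h (P a) ≡ map h (P b)
  binder-case {a = a} {b} ih hab≡ la≡ β a< b< with binder-edge isP la≡ β
  ... | y , e with lift-parallel-edge H hab≡ e
  ... | y′ , e′ , hy′≡hy = begin
    map h (P a)          ≡⟨ cong (map h) Py∷ʳy≡ ⟨
    map h (P y ∷ʳ y)     ≡⟨ map-∷ʳ-cong h Py≈Py′ (sym hy′≡hy) ⟩
    map h (P y′ ∷ʳ y′)   ≡⟨ cong (map h) Py′∷ʳy′≡ ⟩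
    map h (P b)          ∎
    where
      open ≡-Reasoning
      Py∷ʳy≡ : P y ∷ʳ y ≡ P a
      Py∷ʳy≡ = binds isP la≡ β e
      Py′∷ʳy′≡ : P y′ ∷ʳ y′ ≡ P b
      Py′∷ʳy′≡ = binds isP (trans (sym (lab-fiber H hab≡)) la≡) β e′
      Py≈Py′ : map h (P y) ≡ map h (P y′)
      Py≈Py′ = ih y y′ (sym hy′≡hy) (∷ʳ-length-< Py∷ʳy≡ a<) (∷ʳ-length-< Py′∷ʳy′≡ b<)

  scope-case : ∀ {n w₁ w₂ v p} → FiberAgrees n → h w₁ ≡ h w₂ →
               length (P w₁) < suc n → length (P w₂) < suc n →
               P w₁ ≡ p ∷ʳ v → ScopePath G P w₁ v p → map h (P w₁) ≡ map h (P w₂)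
  scope-case {w₁ = w₁} {w₂} {v} {p} ih hw≡ w₁< w₂< Pw₁≡ (m , ws , ws0≡ , steps , (k , last) , inside)
    with shadowed-along m ws (subst (Shadowed (p ∷ʳ v) (P w₂)) (sym ws0≡) (shadowed-start hw≡ Pw₁≡))
                        steps inside m ≤-refl
  ... | u′ , hu≡ , par
    with scope-exit (lab G (ws m)) (prefix-step isP (k , last)) (P-of-entry isP w₁ p v [] Pw₁≡) par
  ... | (_ , β) , Puₘ≡ , Pu′≡ =
    subst₂ (λ xs ys → map h xs ≡ map h ys) Puₘ≡Pw₁ Pu′≡
      (binder-case ih hu≡ refl β (subst (λ xs → length xs < _) (sym Puₘ≡Pw₁) w₁<)
                                 (subst (λ xs → length xs < _) (sym Pu′≡) w₂<))
    where
      Puₘ≡Pw₁ : P (ws m) ≡ P w₁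
      Puₘ≡Pw₁ = trans Puₘ≡ (sym Pw₁≡)

  fiber-agrees : ∀ n → FiberAgrees n
  fiber-agrees zero    a b _ () _
  fiber-agrees (suc n) a b hab≡ a< b< with binder? (lab G a)
  ... | inj₁ (_ , β) = binder-case (fiber-agrees n) hab≡ refl β a< b<
  ... | inj₂ a≢S with ∷ʳ-view (P a) | ∷ʳ-view (P b)
  ... | inj₂ (p , v , Pa≡) | _ =
    scope-case (fiber-agrees n) hab≡ a< b< Pa≡ (scoped a v p Pa≡ a≢S)
  ... | inj₁ _ | inj₂ (p , v , Pb≡) =
    sym (scope-case (fiber-agrees n) (sym hab≡) b< a< Pb≡
                    (scoped b v p Pb≡ (a≢S ∘ trans (lab-fiber H hab≡))))
  ... | inj₁ Pa≡[] | inj₁ Pb≡[] = cong (map h) (trans Pa≡[] (sym Pb≡[]))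

  P-fiber : ∀ {a b} → h a ≡ h b → map h (P a) ≡ map h (P b)
  P-fiber {a} {b} hab≡ =
    fiber-agrees (suc (length (P a) + length (P b))) a b hab≡ (s≤s (m≤m+n _ _)) (s≤s (m≤n+m _ _))

module Descent {G G′ : TermGraph} (H : Hom G G′) {P : V G → List (V G)} (isP : IsAbsPrefix G P)
               (P-fiber : ∀ {a b} → Hom.h H a ≡ Hom.h H b →
                          map (Hom.h H) (P a) ≡ map (Hom.h H) (P b)) where
  open Hom H
  open IsAbsPrefix isP
  open ≡-Reasoning

  -- Opaque, so that matching on surjective H w′ below does not also rewrite inside P′ w′.
  opaque
    P′ : V G′ → List (V G′)
    P′ v′ = map h (P (proj₁ (surjective H v′)))

    P′-h : ∀ w → P′ (h w) ≡ map h (P w)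
    P′-h w = P-fiber (proj₂ (surjective H (h w)))

  P′-∷ʳ : ∀ {u x w} → P u ∷ʳ x ≡ P w → P′ (h u) ∷ʳ h x ≡ P′ (h w)
  P′-∷ʳ {u} {x} {w} Pu∷ʳx≡ = begin
    P′ (h u) ∷ʳ h x     ≡⟨ cong (_∷ʳ h x) (P′-h u) ⟩
    map h (P u) ∷ʳ h x  ≡⟨ map-∷ʳ h (P u) x ⟨
    map h (P u ∷ʳ x)    ≡⟨ cong (map h) Pu∷ʳx≡ ⟩
    map h (P w)         ≡⟨ P′-h w ⟨
    P′ (h w)            ∎

  binder′ : ∀ {u w} → lab G u ≡ lam × P u ∷ʳ u ≡ P w →
            lab G′ (h u) ≡ lam × P′ (h u) ∷ʳ h u ≡ P′ (h w)
  binder′ {u} (lu≡ , Pu∷ʳu≡) = trans (h-lab u) lu≡ , P′-∷ʳ Pu∷ʳu≡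

  isAbsPrefix′ : IsAbsPrefix G′ P′
  IsAbsPrefix.root-ε isAbsPrefix′ =
    subst (λ r → P′ r ≡ []) h-root (trans (P′-h (root G)) (cong (map h) root-ε))
  IsAbsPrefix.lam-arg isAbsPrefix′ w′ u′ l e′ with surjective H w′
  ... | w , refl with lift-edge H e′
  ... | u , e , refl = sym (P′-∷ʳ (sym (lam-arg w u (lab-reflect H l) e)))
  IsAbsPrefix.app-arg isAbsPrefix′ w′ k u′ l e′ with surjective H w′
  ... | w , refl with lift-edge H e′
  ... | u , e , refl =
    trans (P′-h u) (trans (cong (map h) (app-arg w k u (lab-reflect H l) e)) (sym (P′-h w)))
  IsAbsPrefix.zer-ne isAbsPrefix′ w′ l P′w′≡[] with surjective H w′
  ... | w , refl = zer-ne w (lab-reflect H l) (map-≡-[] h (P w) (trans (sym (P′-h w)) P′w′≡[]))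
  IsAbsPrefix.zer-arg isAbsPrefix′ w′ u′ l e′ with surjective H w′
  ... | w , refl with lift-edge H e′
  ... | u , e , refl = binder′ (zer-arg w u (lab-reflect H l) e)
  IsAbsPrefix.S-arg₀ isAbsPrefix′ w′ u′ l e′ with surjective H w′
  ... | w , refl with lift-edge H e′
  ... | u , e , refl = let x , Pu∷ʳx≡ = S-arg₀ w u (lab-reflect H l) e in h x , P′-∷ʳ Pu∷ʳx≡
  IsAbsPrefix.S-arg₁ isAbsPrefix′ w′ u′ l e′ with surjective H w′
  ... | w , refl with lift-edge H e′
  ... | u , e , refl = binder′ (S-arg₁ w u (lab-reflect H l) e)

  ≼-map : ∀ {t z u} → (t ∷ʳ z) ≼ P u → (map h t ∷ʳ h z) ≼ P′ (h u)
  ≼-map {t} {z} {u} (zs , t∷ʳz++zs≡) = map h zs , (begin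
    map h t ∷ʳ h z ++ map h zs   ≡⟨ cong (_++ map h zs) (map-∷ʳ h t z) ⟨
    map h (t ∷ʳ z) ++ map h zs   ≡⟨ map-++ h (t ∷ʳ z) zs ⟨
    map h (t ∷ʳ z ++ zs)         ≡⟨ cong (map h) t∷ʳz++zs≡ ⟩
    map h (P u)                  ≡⟨ P′-h u ⟨
    P′ (h u)                     ∎)

  scope-path′ : ∀ {w v p} → ScopePath G P w v p → ScopePath G′ P′ (h w) (h v) (map h p)
  scope-path′ (n , ws , ws0≡ , steps , last , inside) =
    n , h ∘ ws , cong h ws0≡ , (λ i i<n → map-Edge H (steps i i<n)) ,
    map-Edge H last , λ i i≤n → ≼-map (inside i i≤n)

  eager-path′ : ∀ {w v p} → EagerPath G P w v p → EagerPath G′ P′ (h w) (h v) (map h p)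
  eager-path′ (n , ws , ws0≡ , steps , last-zer , last-edge , inner) =
    n , h ∘ ws , cong h ws0≡ , (λ i i<n → map-Edge H (steps i i<n)) ,
    trans (h-lab (ws n)) last-zer , h-args (ws n) 0 _ last-edge , λ i 1≤i i<n → ≼-map (inner i 1≤i i<n)

  P′-∷ʳ-split : ∀ {w p′ v′} → P′ (h w) ≡ p′ ∷ʳ v′ →
                ∃₂ λ p v → P w ≡ p ∷ʳ v × map h p ≡ p′ × h v ≡ v′
  P′-∷ʳ-split {w} {p′} {v′} P′hw≡ = map-≡-∷ʳ h (P w) p′ v′ (trans (sym (P′-h w)) P′hw≡)

  fullyBackLinked′ : FullyBackLinkedWrt G P → FullyBackLinkedWrt G′ P′
  fullyBackLinked′ fbl w′ v′ p′ P′w′≡ with surjective H w′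
  ... | w , refl with P′-∷ʳ-split P′w′≡
  ... | p , v , Pw≡ , refl , refl = scope-path′ (fbl w v p Pw≡)

  eagerScope′ : EagerScopeWrt G P → EagerScopeWrt G′ P′
  eagerScope′ es w′ v′ p′ P′w′≡ w′≢S with surjective H w′
  ... | w , refl with P′-∷ʳ-split P′w′≡
  ... | p , v , Pw≡ , refl , refl = eager-path′ (es w v p Pw≡ (w′≢S ∘ trans (h-lab w)))

corollary7p9 : (G G′ : TermGraph) → Hom G G′ →
    (FullyBackLinked G → FullyBackLinked G′) × (EagerScope G → EagerScope G′)
corollary7p9 G G′ H = fully-back-linked , eager-scope
  where
    fully-back-linked : FullyBackLinked G → FullyBackLinked G′
    fully-back-linked (P , isP , fbl) = P′ , isAbsPrefix′ , fullyBackLinked′ fbl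
      where open Descent H isP (P-fiber H isP (λ w v p Pw≡ _ → fbl w v p Pw≡))

    eager-scope : EagerScope G → EagerScope G′
    eager-scope (P , isP , es) = P′ , isAbsPrefix′ , eagerScope′ es
      where open Descent H isP (P-fiber H isP (eager⇒scoped isP es))
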